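{- (1) If $\langle G_1,u_1\rangle$ and $\langle G_2,u_2\rangle$ are $\ell u$-frames and $f:\langle G_1,u_1\rangle\to\langle G_2,u_2\rangle$ is a homomorphism of $\ell u$-frames, then $\Gamma(f):[0,u_1]\to[0,u_2]$, the restriction of $f$, is an MV-algebra homomorphism preserving arbitrary joins. (2) If $A,B$ are complete MV-algebras and $\phi:A\to B$ is an MV-algebra homomorphism preserving arbitrary joins, then $\Phi(\phi):\Phi(A)\to\Phi(B)$ is a homomorphism of $\ell u$-frames.
   Context: An $\ell u$-group $\langle G,u\rangle$ is an abelian lattice-ordered group with a strong unit $u\ge0$ (every $x$ satisfies $|x|\le nu$ for some integer $n\ge1$). $\Gamma(G,u)=[0,u]$ is an MV-algebra with $x\oplus y=(x+y)\wedge u$, $\neg x=u-x$; $\Gamma$ is a functor giving the Chang–Mundici equivalence between $\ell u$-groups (with unit-preserving $\ell$-group homomorphisms) and MV-algebras, with inverse functor $\Phi$ (so $\Phi(\phi)$ is the unique unit-preserving $\ell$-homomorphism whose restriction to the unit intervals is $\phi$, up to the identifications $\Gamma\Phi\cong\mathrm{id}$). An $\ell u$-frame is an $\ell u$-group whose group is complete (every nonempty bounded subset has a supremum and an infimum). A homomorphism of $\ell u$-frames $\langle G_1,u_1\rangle\to\langle G_2,u_2\rangle$ is a group and lattice homomorphism $G_1\to G_2$ preserving all existing arbitrary suprema and mapping $u_1$ to $u_2$. -}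

module Defs where

open import Level using (0ℓ)
open import Data.Nat using (ℕ; zero; suc)
open import Data.Product using (Σ; ∃; _×_; _,_; proj₁; proj₂)
open import Relation.Unary using (Pred)
open import Relation.Binary using (Rel; Setoid)
open import Algebra.Structures using (IsAbelianGroup)
open import Algebra.Lattice.Structures using (IsLattice)
import Relation.Binary.Reasoning.Setoid as SetoidReasoning

module Order {A : Set} (_≈_ : Rel A 0ℓ) (_≤_ : Rel A 0ℓ) where

  IsUpperBound : Pred A 0ℓ → A → Set
  IsUpperBound S b = ∀ x → S x → x ≤ b

  IsLowerBound : Pred A 0ℓ → A → Set
  IsLowerBound S b = ∀ x → S x → b ≤ x

  IsSup : Pred A 0ℓ → A → Set
  IsSup S s = IsUpperBound S s × (∀ b → IsUpperBound S b → s ≤ b)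

  IsInf : Pred A 0ℓ → A → Set
  IsInf S s = IsLowerBound S s × (∀ b → IsLowerBound S b → b ≤ s)

image : {A B : Set} (_≈_ : Rel B 0ℓ) → (A → B) → Pred A 0ℓ → Pred B 0ℓ
image _≈_ f S y = ∃ λ x → S x × (f x ≈ y)

record LGroup : Set₁ where
  infixl 6 _+_
  infixr 7 _∧_
  infixr 6 _∨_
  infix 4 _≈_ _≤_
  field
    Carrier : Set
    _≈_     : Rel Carrier 0ℓ
    _+_     : Carrier → Carrier → Carrier
    0#      : Carrier
    -_      : Carrier → Carrier
    _∨_     : Carrier → Carrier → Carrier
    _∧_     : Carrier → Carrier → Carrier
    isAbelianGroup : IsAbelianGroup _≈_ _+_ 0# -_
    isLattice      : IsLattice _≈_ _∨_ _∧_
    +-distribˡ-∨   : ∀ x y z → x + (y ∨ z) ≈ (x + y) ∨ (x + z)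
    +-distribˡ-∧   : ∀ x y z → x + (y ∧ z) ≈ (x + y) ∧ (x + z)

  _≤_ : Rel Carrier 0ℓ
  x ≤ y = x ∧ y ≈ x

  ∣_∣ : Carrier → Carrier
  ∣ x ∣ = x ∨ (- x)

  _·_ : ℕ → Carrier → Carrier
  zero  · x = 0#
  suc n · x = x + (n · x)

  open Order _≈_ _≤_ public

record LUGroup : Set₁ where
  field
    lgroup : LGroup
  open LGroup lgroup public
  field
    u       : Carrier
    0≤u     : 0# ≤ u
    strong  : ∀ x → ∃ λ n → ∣ x ∣ ≤ (suc n · u)

IsLUFrame : LUGroup → Set₁
IsLUFrame G =
  ∀ (S : Pred Carrier 0ℓ) → (∃ λ x → S x) →
    (∃ λ b → IsUpperBound S b) → (∃ λ b → IsLowerBound S b) →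
    (∃ λ s → IsSup S s) × (∃ λ i → IsInf S i)
  where open LUGroup G

record IsLUHom (G H : LUGroup) (f : LUGroup.Carrier G → LUGroup.Carrier H) : Set where
  private
    module G = LUGroup G
    module H = LUGroup H
  field
    cong   : ∀ {x y} → x G.≈ y → f x H.≈ f y
    +-homo : ∀ x y → f (x G.+ y) H.≈ (f x H.+ f y)
    0-homo : f G.0# H.≈ H.0#
    ∨-homo : ∀ x y → f (x G.∨ y) H.≈ (f x H.∨ f y)
    ∧-homo : ∀ x y → f (x G.∧ y) H.≈ (f x H.∧ f y)
    u-homo : f G.u H.≈ H.u

record IsLUFrameHom (G H : LUGroup) (f : LUGroup.Carrier G → LUGroup.Carrier H) : Set₁ where
  private
    module G = LUGroup G
    module H = LUGroup H
  field
    isLUHom  : IsLUHom G H f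
    sup-homo : ∀ (S : Pred G.Carrier 0ℓ) s → G.IsSup S s → H.IsSup (image H._≈_ f S) (f s)

record MVAlgebra : Set₁ where
  infixl 6 _⊕_
  infix 4 _≈_ _≤_
  field
    Carrier : Set
    _≈_     : Rel Carrier 0ℓ
    _⊕_     : Carrier → Carrier → Carrier
    ¬_      : Carrier → Carrier
    0#      : Carrier

  1# : Carrier
  1# = ¬ 0#

  _≤_ : Rel Carrier 0ℓ
  x ≤ y = (¬ x) ⊕ y ≈ 1#

  open Order _≈_ _≤_ public

record IsMVAlgebra (A : MVAlgebra) : Set where
  open MVAlgebra A
  field
    ≈-refl  : ∀ {x} → x ≈ x
    ≈-sym   : ∀ {x y} → x ≈ y → y ≈ x
    ≈-trans : ∀ {x y z} → x ≈ y → y ≈ z → x ≈ z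
    ⊕-cong  : ∀ {x y x' y'} → x ≈ x' → y ≈ y' → (x ⊕ y) ≈ (x' ⊕ y')
    ¬-cong  : ∀ {x y} → x ≈ y → (¬ x) ≈ (¬ y)
    ⊕-assoc : ∀ x y z → (x ⊕ (y ⊕ z)) ≈ ((x ⊕ y) ⊕ z)
    ⊕-comm  : ∀ x y → (x ⊕ y) ≈ (y ⊕ x)
    ⊕-0     : ∀ x → (x ⊕ 0#) ≈ x
    ¬¬      : ∀ x → (¬ (¬ x)) ≈ x
    ⊕-1     : ∀ x → (x ⊕ 1#) ≈ 1#
    łuk     : ∀ x y → ((¬ ((¬ x) ⊕ y)) ⊕ y) ≈ ((¬ ((¬ y) ⊕ x)) ⊕ x)

IsCompleteMV : MVAlgebra → Set₁
IsCompleteMV A = ∀ (S : Pred Carrier 0ℓ) → ∃ λ s → IsSup S s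
  where open MVAlgebra A

record IsMVHom (A B : MVAlgebra) (f : MVAlgebra.Carrier A → MVAlgebra.Carrier B) : Set where
  private
    module A = MVAlgebra A
    module B = MVAlgebra B
  field
    cong   : ∀ {x y} → x A.≈ y → f x B.≈ f y
    ⊕-homo : ∀ x y → f (x A.⊕ y) B.≈ (f x B.⊕ f y)
    ¬-homo : ∀ x → f (A.¬ x) B.≈ (B.¬ f x)
    0-homo : f A.0# B.≈ B.0#

PreservesJoins : (A B : MVAlgebra) → (MVAlgebra.Carrier A → MVAlgebra.Carrier B) → Set₁
PreservesJoins A B f =
  ∀ (S : Pred A.Carrier 0ℓ) s → A.IsSup S s → B.IsSup (image B._≈_ f S) (f s)
  where
    module A = MVAlgebra A
    module B = MVAlgebra B

record IsMVIso (A B : MVAlgebra) (f : MVAlgebra.Carrier A → MVAlgebra.Carrier B) : Set where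
  private
    module A = MVAlgebra A
    module B = MVAlgebra B
  field
    isMVHom    : IsMVHom A B f
    injective  : ∀ {x y} → f x B.≈ f y → x A.≈ y
    surjective : ∀ b → ∃ λ a → f a B.≈ b

module ΓLemmas (G : LUGroup) where
  open LUGroup G
  open IsAbelianGroup isAbelianGroup using (setoid; ∙-cong; inverseˡ; inverseʳ; identityʳ; identityˡ; assoc; comm)
    renaming (refl to ≈refl; sym to ≈sym)
  open IsLattice isLattice using (∧-assoc; ∧-cong; ∧-comm; ∧-absorbs-∨; ∨-absorbs-∧)
  open SetoidReasoning setoid

  ≤-trans : ∀ {x y z} → x ≤ y → y ≤ z → x ≤ z
  ≤-trans {x} {y} {z} p q = begin
    x ∧ z        ≈⟨ ∧-cong (≈sym p) ≈refl ⟩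
    (x ∧ y) ∧ z  ≈⟨ ∧-assoc x y z ⟩
    x ∧ (y ∧ z)  ≈⟨ ∧-cong ≈refl q ⟩
    x ∧ y        ≈⟨ p ⟩
    x            ∎

  ∧-idem : ∀ x → x ∧ x ≈ x
  ∧-idem x = begin
    x ∧ x              ≈⟨ ∧-cong ≈refl (≈sym (∨-absorbs-∧ x x)) ⟩
    x ∧ (x ∨ (x ∧ x))  ≈⟨ ∧-absorbs-∨ x (x ∧ x) ⟩
    x                  ∎

  ≤-∧ : ∀ {z x y} → z ≤ x → z ≤ y → z ≤ x ∧ y
  ≤-∧ {z} {x} {y} p q = begin
    z ∧ (x ∧ y)  ≈⟨ ≈sym (∧-assoc z x y) ⟩
    (z ∧ x) ∧ y  ≈⟨ ∧-cong p ≈refl ⟩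
    z ∧ y        ≈⟨ q ⟩
    z            ∎

  ∧≤r : ∀ x y → x ∧ y ≤ y
  ∧≤r x y = begin
    (x ∧ y) ∧ y  ≈⟨ ∧-assoc x y y ⟩
    x ∧ (y ∧ y)  ≈⟨ ∧-cong ≈refl (∧-idem y) ⟩
    x ∧ y        ∎

  ≤+ : ∀ x {y} → 0# ≤ y → x ≤ x + y
  ≤+ x {y} p = begin
    x ∧ (x + y)         ≈⟨ ∧-cong (≈sym (identityʳ x)) ≈refl ⟩
    (x + 0#) ∧ (x + y)  ≈⟨ ≈sym (+-distribˡ-∧ x 0# y) ⟩
    x + (0# ∧ y)        ≈⟨ ∙-cong ≈refl p ⟩
    x + 0#              ≈⟨ identityʳ x ⟩
    x                   ∎

  0≤+ : ∀ {x y} → 0# ≤ x → 0# ≤ y → 0# ≤ x + y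
  0≤+ {x} p q = ≤-trans p (≤+ x q)

  0≤u- : ∀ {x} → x ≤ u → 0# ≤ u + (- x)
  0≤u- {x} p = begin
    0# ∧ (u + (- x))             ≈⟨ ∧-cong (≈sym (inverseˡ x)) (comm u (- x)) ⟩
    ((- x) + x) ∧ ((- x) + u)    ≈⟨ ≈sym (+-distribˡ-∧ (- x) x u) ⟩
    (- x) + (x ∧ u)              ≈⟨ ∙-cong ≈refl p ⟩
    (- x) + x                    ≈⟨ inverseˡ x ⟩
    0#                           ∎

  u-≤u : ∀ {x} → 0# ≤ x → u + (- x) ≤ u
  u-≤u {x} p = begin
    (u + (- x)) ∧ u                        ≈⟨ ∧-cong ≈refl (≈sym e) ⟩
    (u + (- x)) ∧ ((u + (- x)) + x)        ≈⟨ ∧-cong (≈sym (identityʳ _)) ≈refl ⟩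
    ((u + (- x)) + 0#) ∧ ((u + (- x)) + x) ≈⟨ ≈sym (+-distribˡ-∧ _ 0# x) ⟩
    (u + (- x)) + (0# ∧ x)                 ≈⟨ ∙-cong ≈refl p ⟩
    (u + (- x)) + 0#                       ≈⟨ identityʳ _ ⟩
    u + (- x)                              ∎
    where
    e : (u + (- x)) + x ≈ u
    e = begin
      (u + (- x)) + x  ≈⟨ assoc u (- x) x ⟩
      u + ((- x) + x)  ≈⟨ ∙-cong ≈refl (inverseˡ x) ⟩
      u + 0#           ≈⟨ identityʳ u ⟩
      u                ∎

  0≤0 : 0# ≤ 0#
  0≤0 = ∧-idem 0#

InUnit : (G : LUGroup) → LUGroup.Carrier G → Set
InUnit G x = (0# ≤ x) × (x ≤ u)
  where open LUGroup G

Γ : LUGroup → MVAlgebra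
Γ G = record
  { Carrier = Σ Carrier (InUnit G)
  ; _≈_     = λ x y → proj₁ x ≈ proj₁ y
  ; _⊕_     = λ x y → ((proj₁ x + proj₁ y) ∧ u)
                      , (≤-∧ (0≤+ (proj₁ (proj₂ x)) (proj₁ (proj₂ y))) 0≤u
                        , ∧≤r _ _)
  ; ¬_      = λ x → (u + (- proj₁ x)) , (0≤u- (proj₂ (proj₂ x)) , u-≤u (proj₁ (proj₂ x)))
  ; 0#      = 0# , (0≤0 , 0≤u)
  }
  where
  open LUGroup G
  open ΓLemmas G

module _ (G H : LUGroup) (f : LUGroup.Carrier G → LUGroup.Carrier H) (hom : IsLUHom G H f) where
  private
    module G = LUGroup G
    module H = LUGroup H
    open IsLUHom hom
    open IsAbelianGroup H.isAbelianGroup using (setoid) renaming (refl to ≈refl; sym to ≈sym)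
    open IsLattice H.isLattice using (∧-cong)
    open SetoidReasoning setoid

    pres : ∀ x → InUnit G x → InUnit H (f x)
    pres x (p , q) = p' , q'
      where
      p' : H.0# H.≤ f x
      p' = begin
        H.0# H.∧ f x    ≈⟨ ∧-cong (≈sym 0-homo) ≈refl ⟩
        f G.0# H.∧ f x  ≈⟨ ≈sym (∧-homo G.0# x) ⟩
        f (G.0# G.∧ x)  ≈⟨ cong p ⟩
        f G.0#          ≈⟨ 0-homo ⟩
        H.0#            ∎
      q' : f x H.≤ H.u
      q' = begin
        f x H.∧ H.u    ≈⟨ ∧-cong ≈refl (≈sym u-homo) ⟩
        f x H.∧ f G.u  ≈⟨ ≈sym (∧-homo x G.u) ⟩
        f (x G.∧ G.u)  ≈⟨ cong q ⟩
        f x            ∎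

  Γmap : MVAlgebra.Carrier (Γ G) → MVAlgebra.Carrier (Γ H)
  Γmap (x , p) = f x , pres x p

{-# OPTIONS --safe #-}
-- Γ G is [0,u] carrying the order of G, and t is the join of T in Γ G iff t is the supremum
-- of T ∪ {0} in G; so an ℓu-frame homomorphism restricts to a join-preserving MV-homomorphism.
--
-- Conversely, completeness of Γ G ≅ A makes G complete: a nonempty subset of [0, c + d] has
-- supremum sup {x ∧ c} + sup {(x - c) ∨ 0}, so completeness of [0,u] spreads to every [0, n u],
-- hence (by the strong unit) to every [0,c], and after a translation to every nonempty set
-- bounded above; infima are suprema of negatives. For h, note that s = sup S iff the clipped
-- translates ((x + u - s) ∨ 0) ∧ u, x ∈ S, have join u in Γ G. The "if" direction rests on the
-- strong unit: x + u ≤ x ∨ u forces x ≤ 0. A unit-preserving ℓ-homomorphism commutes with the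
-- clipping, and Γ h preserves joins because φ does and α, β are isomorphisms; hence h
-- preserves suprema.
module Submission where

open import Defs
open import Level using (0ℓ)
open import Data.Nat using (zero; suc)
open import Data.Product using (∃; _×_; _,_; proj₁; proj₂)
open import Data.Sum using (inj₁; inj₂)
open import Relation.Unary using (Pred; _∪_; _⊆_; _≐_)
open import Function using (id; _⇔_; mk⇔)
open import Function.Bundles using (module Equivalence)
open Equivalence using (to; from)
open import Relation.Binary using (Rel; IsPartialOrder; Poset; _Respects₂_)
open import Algebra.Bundles using (AbelianGroup)
import Algebra.Lattice.Bundles as Alg
import Algebra.Lattice.Properties.Lattice as AlgLatticeProperties
import Relation.Binary.Lattice as Ord
import Relation.Binary.Lattice.Properties.JoinSemilattice as JoinSemilatticeProperties
import Algebra.Properties.AbelianGroup as AbelianGroupProperties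
import Algebra.Properties.CommutativeSemigroup as CommutativeSemigroupProperties
import Relation.Binary.Reasoning.Setoid as SetoidReasoning
import Relation.Binary.Reasoning.PartialOrder as PosetReasoning

module SupProperties {A : Set} (_≈_ _≤_ : Rel A 0ℓ) where
  open Order _≈_ _≤_

  IsSup-resp-upperBounds : ∀ {S S′ s} → IsUpperBound S ≐ IsUpperBound S′ → IsSup S s → IsSup S′ s
  IsSup-resp-upperBounds (S-ub⇒S′-ub , S′-ub⇒S-ub) (ub , least) =
    S-ub⇒S′-ub ub , λ b b-ub → least b (S′-ub⇒S-ub b-ub)

  IsSup-resp : _≤_ Respects₂ _≈_ → ∀ {S S′ s s′} →
               S ⊆ image _≈_ id S′ → S′ ⊆ image _≈_ id S → s ≈ s′ → IsSup S s → IsSup S′ s′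
  IsSup-resp (≤-respʳ , ≤-respˡ) S⊆S′ S′⊆S s≈s′ (ub , least) =
    (λ y S′y → let x , Sx , x≈y = S′⊆S S′y in ≤-respʳ s≈s′ (≤-respˡ x≈y (ub x Sx))) ,
    (λ b b-ub → ≤-respˡ s≈s′ (least b λ x Sx → let y , S′y , y≈x = S⊆S′ Sx in ≤-respˡ y≈x (b-ub y S′y)))

module LGroupProperties (G : LGroup) where
  open LGroup G

  abelianGroup : AbelianGroup 0ℓ 0ℓ
  abelianGroup = record { isAbelianGroup = isAbelianGroup }

  open AbelianGroup abelianGroup public
    using (setoid; refl; sym; trans)
    renaming (∙-cong to +-cong; ∙-congˡ to +-congˡ; ∙-congʳ to +-congʳ; ⁻¹-cong to -‿cong;
              assoc to +-assoc; comm to +-comm; identityˡ to +-identityˡ; identityʳ to +-identityʳ;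
              inverseʳ to -‿inverseʳ)
  open AbelianGroupProperties abelianGroup public
    using (ε⁻¹≈ε; ⁻¹-involutive; xyx⁻¹≈y; ⁻¹-anti-homo‿-; \\-leftDividesʳ; //-rightDividesˡ; //-rightDividesʳ)

  open CommutativeSemigroupProperties (AbelianGroup.commutativeSemigroup abelianGroup) using (x∙yz≈y∙xz)

  lattice : Alg.Lattice 0ℓ 0ℓ
  lattice = record { isLattice = isLattice }

  open Alg.Lattice lattice public using (∧-comm; ∨-comm; ∧-cong; ∨-cong)

  private
    module NaturalOrder = Poset (AlgLatticeProperties.poset lattice)
    module NaturalLattice = Ord.IsLattice (AlgLatticeProperties.∨-∧-isOrderTheoreticLattice lattice)

  ≤-isPartialOrder : IsPartialOrder _≈_ _≤_
  ≤-isPartialOrder = record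
    { isPreorder = record
      { isEquivalence = AbelianGroup.isEquivalence abelianGroup
      ; reflexive     = λ x≈y → sym (NaturalOrder.reflexive x≈y)
      ; trans         = λ x≤y y≤z → sym (NaturalOrder.trans (sym x≤y) (sym y≤z))
      }
    ; antisym = λ x≤y y≤x → NaturalOrder.antisym (sym x≤y) (sym y≤x)
    }

  orderLattice : Ord.Lattice 0ℓ 0ℓ 0ℓ
  orderLattice = record
    { isLattice = record
      { isPartialOrder = ≤-isPartialOrder
      ; supremum = λ x y → sym (NaturalLattice.x≤x∨y x y) , sym (NaturalLattice.y≤x∨y x y) ,
                           λ z x≤z y≤z → sym (NaturalLattice.∨-least (sym x≤z) (sym y≤z))
      ; infimum  = λ x y → sym (NaturalLattice.x∧y≤x x y) , sym (NaturalLattice.x∧y≤y x y) ,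
                           λ z z≤x z≤y → sym (NaturalLattice.∧-greatest (sym z≤x) (sym z≤y))
      }
    }

  open Ord.Lattice orderLattice public
    using (poset; joinSemilattice; x≤x∨y; y≤x∨y; ∨-least; x∧y≤x; x∧y≤y; ∧-greatest)
    renaming (refl to ≤-refl; reflexive to ≤-reflexive; trans to ≤-trans; antisym to ≤-antisym;
              ≲-resp-≈ to ≤-resp-≈; ≲-respˡ-≈ to ≤-respˡ-≈; ≲-respʳ-≈ to ≤-respʳ-≈)
  open JoinSemilatticeProperties joinSemilattice public using (∨-monotonic)

  infixl 6 _-_
  _-_ : Carrier → Carrier → Carrier
  x - y = x + (- y)

  +-monoʳ-≤ : ∀ c {x y} → x ≤ y → c + x ≤ c + y
  +-monoʳ-≤ c {x} {y} x≤y = begin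
    (c + x) ∧ (c + y)  ≈⟨ +-distribˡ-∧ c x y ⟨
    c + (x ∧ y)        ≈⟨ +-congˡ x≤y ⟩
    c + x              ∎
    where open SetoidReasoning setoid

  +-monoˡ-≤ : ∀ c {x y} → x ≤ y → x + c ≤ y + c
  +-monoˡ-≤ c x≤y = ≤-respˡ-≈ (+-comm c _) (≤-respʳ-≈ (+-comm c _) (+-monoʳ-≤ c x≤y))

  +-mono-≤ : ∀ {x x′ y y′} → x ≤ x′ → y ≤ y′ → x + y ≤ x′ + y′
  +-mono-≤ {x′ = x′} {y} x≤x′ y≤y′ = ≤-trans (+-monoˡ-≤ y x≤x′) (+-monoʳ-≤ x′ y≤y′)

  x+y≤z⇒x≤z-y : ∀ {x y z} → x + y ≤ z → x ≤ z - y
  x+y≤z⇒x≤z-y {x} {y} x+y≤z = ≤-respˡ-≈ (//-rightDividesʳ y x) (+-monoˡ-≤ (- y) x+y≤z)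

  x≤z-y⇒x+y≤z : ∀ {x y z} → x ≤ z - y → x + y ≤ z
  x≤z-y⇒x+y≤z {y = y} {z} x≤z-y = ≤-respʳ-≈ (//-rightDividesˡ y z) (+-monoˡ-≤ y x≤z-y)

  x≤z+y⇒x-y≤z : ∀ {x y z} → x ≤ z + y → x - y ≤ z
  x≤z+y⇒x-y≤z {y = y} {z} x≤z+y = ≤-respʳ-≈ (//-rightDividesʳ y z) (+-monoˡ-≤ (- y) x≤z+y)

  x-y≤0⇒x≤y : ∀ {x y} → x - y ≤ 0# → x ≤ y
  x-y≤0⇒x≤y {x} {y} x-y≤0 = ≤-respˡ-≈ (//-rightDividesˡ y x) (≤-respʳ-≈ (+-identityˡ y) (+-monoˡ-≤ y x-y≤0))

  +-cancelˡ-≤ : ∀ c {x y} → c + x ≤ c + y → x ≤ y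
  +-cancelˡ-≤ c {x} {y} c+x≤c+y =
    ≤-respˡ-≈ (\\-leftDividesʳ c x) (≤-respʳ-≈ (\\-leftDividesʳ c y) (+-monoʳ-≤ (- c) c+x≤c+y))

  +-cancelʳ-≤ : ∀ c {x y} → x + c ≤ y + c → x ≤ y
  +-cancelʳ-≤ c {y = y} x+c≤y+c = ≤-respʳ-≈ (//-rightDividesʳ c y) (x+y≤z⇒x≤z-y x+c≤y+c)

  c≤c-x+y⇔x≤y : ∀ c {x y} → c ≤ c - x + y ⇔ x ≤ y
  c≤c-x+y⇔x≤y c {x} = mk⇔
    (λ c≤c-x+y → +-cancelˡ-≤ (c - x) (≤-respˡ-≈ (sym (//-rightDividesˡ x c)) c≤c-x+y))
    (λ x≤y → ≤-respˡ-≈ (//-rightDividesˡ x c) (+-monoʳ-≤ (c - x) x≤y))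

  neg-antimono-≤ : ∀ {x y} → x ≤ y → - y ≤ - x
  neg-antimono-≤ {x} {y} x≤y = begin
    - y                ≈⟨ \\-leftDividesʳ x (- y) ⟨
    - x + (x - y)      ≤⟨ +-monoʳ-≤ (- x) (+-monoˡ-≤ (- y) x≤y) ⟩
    - x + (y - y)      ≈⟨ +-congˡ (-‿inverseʳ y) ⟩
    - x + 0#           ≈⟨ +-identityʳ (- x) ⟩
    - x                ∎
    where open PosetReasoning poset

  -x≤y⇒-y≤x : ∀ {x y} → - x ≤ y → - y ≤ x
  -x≤y⇒-y≤x {x} -x≤y = ≤-respʳ-≈ (⁻¹-involutive x) (neg-antimono-≤ -x≤y)

  x≤-y⇒y≤-x : ∀ {x y} → x ≤ - y → y ≤ - x
  x≤-y⇒y≤-x {y = y} x≤-y = ≤-respˡ-≈ (⁻¹-involutive y) (neg-antimono-≤ x≤-y)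

  neg-distrib-∧ : ∀ x y → - (x ∧ y) ≈ - x ∨ - y
  neg-distrib-∧ x y = ≤-antisym
    (-x≤y⇒-y≤x (∧-greatest (-x≤y⇒-y≤x (x≤x∨y (- x) (- y))) (-x≤y⇒-y≤x (y≤x∨y (- x) (- y)))))
    (∨-least (neg-antimono-≤ (x∧y≤x x y)) (neg-antimono-≤ (x∧y≤y x y)))

  x+[y-x]≈y : ∀ x y → x + (y - x) ≈ y
  x+[y-x]≈y x y = trans (+-comm x (y - x)) (//-rightDividesˡ x y)

  x+[y-z]≈y-[z-x] : ∀ x y z → x + (y - z) ≈ y - (z - x)
  x+[y-z]≈y-[z-x] x y z = begin
    x + (y - z)       ≈⟨ x∙yz≈y∙xz x y (- z) ⟩
    y + (x - z)       ≈⟨ +-congˡ (⁻¹-anti-homo‿- z x) ⟨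
    y - (z - x)       ∎
    where open SetoidReasoning setoid

  +-distribʳ-∨ : ∀ x y z → (y ∨ z) + x ≈ (y + x) ∨ (z + x)
  +-distribʳ-∨ x y z = begin
    (y ∨ z) + x         ≈⟨ +-comm (y ∨ z) x ⟩
    x + (y ∨ z)         ≈⟨ +-distribˡ-∨ x y z ⟩
    (x + y) ∨ (x + z)   ≈⟨ ∨-cong (+-comm x y) (+-comm x z) ⟩
    (y + x) ∨ (z + x)   ∎
    where open SetoidReasoning setoid

  ∧+∨≈+ : ∀ x y → (x ∧ y) + (x ∨ y) ≈ x + y
  ∧+∨≈+ x y = trans (+-congˡ (sym [x+y]-[x∧y]≈x∨y)) (x+[y-x]≈y (x ∧ y) (x + y))
    where
    open SetoidReasoning setoid
    [x+y]-[x∧y]≈x∨y : (x + y) - (x ∧ y) ≈ x ∨ y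
    [x+y]-[x∧y]≈x∨y = begin
      (x + y) - (x ∧ y)                    ≈⟨ +-congˡ (neg-distrib-∧ x y) ⟩
      (x + y) + (- x ∨ - y)                ≈⟨ +-distribˡ-∨ (x + y) (- x) (- y) ⟩
      (x + y - x) ∨ (x + y - y)            ≈⟨ ∨-cong (xyx⁻¹≈y x y) (//-rightDividesʳ y x) ⟩
      y ∨ x                                ≈⟨ ∨-comm y x ⟩
      x ∨ y                                ∎

  [x-c]∨0≈x∨c-c : ∀ x c → (x - c) ∨ 0# ≈ (x ∨ c) - c
  [x-c]∨0≈x∨c-c x c = begin
    (x - c) ∨ 0#        ≈⟨ ∨-cong refl (-‿inverseʳ c) ⟨
    (x - c) ∨ (c - c)   ≈⟨ +-distribʳ-∨ (- c) x c ⟨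
    (x ∨ c) - c         ∎
    where open SetoidReasoning setoid

  x≈x∧c+[x-c]∨0 : ∀ x c → x ≈ (x ∧ c) + ((x - c) ∨ 0#)
  x≈x∧c+[x-c]∨0 x c = sym (begin
    (x ∧ c) + ((x - c) ∨ 0#)     ≈⟨ +-congˡ ([x-c]∨0≈x∨c-c x c) ⟩
    (x ∧ c) + ((x ∨ c) - c)      ≈⟨ +-assoc (x ∧ c) (x ∨ c) (- c) ⟨
    (x ∧ c) + (x ∨ c) - c        ≈⟨ +-congʳ (∧+∨≈+ x c) ⟩
    x + c - c                    ≈⟨ //-rightDividesʳ c x ⟩
    x                            ∎)
    where open SetoidReasoning setoid

  x∧c+[y-c]∨0≤x∨y : ∀ x y c → (x ∧ c) + ((y - c) ∨ 0#) ≤ x ∨ y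
  x∧c+[y-c]∨0≤x∨y x y c = begin
    (x ∧ c) + ((y - c) ∨ 0#)              ≈⟨ +-distribˡ-∨ (x ∧ c) (y - c) 0# ⟩
    ((x ∧ c) + (y - c)) ∨ ((x ∧ c) + 0#)  ≤⟨ ∨-monotonic (+-monoˡ-≤ (y - c) (x∧y≤y x c))
                                                          (≤-reflexive (+-identityʳ (x ∧ c))) ⟩
    (c + (y - c)) ∨ (x ∧ c)               ≤⟨ ∨-monotonic (≤-reflexive (x+[y-x]≈y c y)) (x∧y≤x x c) ⟩
    y ∨ x                                 ≈⟨ ∨-comm y x ⟩
    x ∨ y                                 ∎
    where open PosetReasoning poset

  0≤x⇒0≤n·x : ∀ n {x} → 0# ≤ x → 0# ≤ n · x
  0≤x⇒0≤n·x zero    0≤x = ≤-refl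
  0≤x⇒0≤n·x (suc n) 0≤x = ≤-respˡ-≈ (+-identityʳ 0#) (+-mono-≤ 0≤x (0≤x⇒0≤n·x n 0≤x))

  open SupProperties _≈_ _≤_

  IsSup-singleton : ∀ c → IsSup (_≈ c) c
  IsSup-singleton c = (λ x x≈c → ≤-reflexive x≈c) , (λ b b-ub → b-ub c refl)

  _⊞_ : Pred Carrier 0ℓ → Pred Carrier 0ℓ → Pred Carrier 0ℓ
  (S ⊞ S′) z = ∃ λ x → ∃ λ y → S x × S′ y × x + y ≈ z

  IsSup-⊞ : ∀ {S S′ s s′} → IsSup S s → IsSup S′ s′ → IsSup (S ⊞ S′) (s + s′)
  IsSup-⊞ {S} {S′} {s} {s′} (ub , least) (ub′ , least′) =
    (λ z (x , y , Sx , S′y , x+y≈z) → ≤-respˡ-≈ x+y≈z (+-mono-≤ (ub x Sx) (ub′ y S′y))) ,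
    (λ b b-ub → ≤-respˡ-≈ (+-comm s′ s) (x≤z-y⇒x+y≤z (least′ (b - s) λ y S′y →
                  x+y≤z⇒x≤z-y (≤-respˡ-≈ (+-comm s y) (s+y≤b b b-ub y S′y)))))
    where
    s+y≤b : ∀ b → IsUpperBound (S ⊞ S′) b → ∀ y → S′ y → s + y ≤ b
    s+y≤b b b-ub y S′y =
      x≤z-y⇒x+y≤z (least (b - y) λ x Sx → x+y≤z⇒x≤z-y (b-ub (x + y) (x , y , Sx , S′y , refl)))

  IsSup-neg⇒IsInf : ∀ {S s} → IsSup (image _≈_ -_ S) s → IsInf S (- s)
  IsSup-neg⇒IsInf (ub , least) =
    (λ x Sx → -x≤y⇒-y≤x (ub (- x) (x , Sx , refl))) ,
    (λ b b-lb → x≤-y⇒y≤-x (least (- b) λ z (x , Sx , -x≈z) → ≤-respˡ-≈ -x≈z (neg-antimono-≤ (b-lb x Sx))))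

  IntervalComplete : Carrier → Set₁
  IntervalComplete c = ∀ (S : Pred Carrier 0ℓ) → ∃ S → (∀ {x} → S x → 0# ≤ x × x ≤ c) → ∃ (IsSup S)

  IntervalComplete-0 : IntervalComplete 0#
  IntervalComplete-0 S (e , Se) S⊆[0,0] =
    0# , (λ x Sx → proj₂ (S⊆[0,0] Sx)) , (λ b b-ub → ≤-trans (proj₁ (S⊆[0,0] Se)) (b-ub e Se))

  IntervalComplete-≤ : ∀ {c d} → c ≤ d → IntervalComplete d → IntervalComplete c
  IntervalComplete-≤ c≤d complete S ne S⊆[0,c] =
    complete S ne λ Sx → proj₁ (S⊆[0,c] Sx) , ≤-trans (proj₂ (S⊆[0,c] Sx)) c≤d

  IntervalComplete-+ : ∀ {c d} → 0# ≤ c → 0# ≤ d →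
                       IntervalComplete c → IntervalComplete d → IntervalComplete (c + d)
  IntervalComplete-+ {c} {d} 0≤c 0≤d complete-c complete-d S (e , Se) S⊆[0,c+d] =
    let s₁ , sup₁ = complete-c Sᶜ (e ∧ c , e , Se , refl) Sᶜ⊆[0,c]
        s₂ , sup₂ = complete-d Sᵈ ((e - c) ∨ 0# , e , Se , refl) Sᵈ⊆[0,d]
    in s₁ + s₂ , IsSup-resp-upperBounds (ub-⊞⇒ub , ub⇒ub-⊞) (IsSup-⊞ sup₁ sup₂)
    where
    Sᶜ Sᵈ : Pred Carrier 0ℓ
    Sᶜ = image _≈_ (_∧ c) S
    Sᵈ = image _≈_ (λ x → (x - c) ∨ 0#) S

    Sᶜ⊆[0,c] : ∀ {x} → Sᶜ x → 0# ≤ x × x ≤ c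
    Sᶜ⊆[0,c] (y , Sy , y∧c≈x) =
      ≤-respʳ-≈ y∧c≈x (∧-greatest (proj₁ (S⊆[0,c+d] Sy)) 0≤c) , ≤-respˡ-≈ y∧c≈x (x∧y≤y y c)

    Sᵈ⊆[0,d] : ∀ {x} → Sᵈ x → 0# ≤ x × x ≤ d
    Sᵈ⊆[0,d] (y , Sy , eq) =
      ≤-respʳ-≈ eq (y≤x∨y _ 0#) ,
      ≤-respˡ-≈ eq (∨-least (x≤z+y⇒x-y≤z (≤-respʳ-≈ (+-comm c d) (proj₂ (S⊆[0,c+d] Sy)))) 0≤d)

    ub-⊞⇒ub : IsUpperBound (Sᶜ ⊞ Sᵈ) ⊆ IsUpperBound S
    ub-⊞⇒ub b-ub y Sy =
      ≤-respˡ-≈ (sym (x≈x∧c+[x-c]∨0 y c)) (b-ub _ (_ , _ , (y , Sy , refl) , (y , Sy , refl) , refl))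

    ub⇒ub-⊞ : IsUpperBound S ⊆ IsUpperBound (Sᶜ ⊞ Sᵈ)
    ub⇒ub-⊞ b-ub z (_ , _ , (y , Sy , y∧c≈a) , (y′ , Sy′ , eq) , a+a′≈z) =
      ≤-respˡ-≈ (trans (+-cong y∧c≈a eq) a+a′≈z)
                (≤-trans (x∧c+[y-c]∨0≤x∨y y y′ c) (∨-least (b-ub y Sy) (b-ub y′ Sy′)))

  IntervalComplete-· : ∀ {c} → 0# ≤ c → IntervalComplete c → ∀ n → IntervalComplete (n · c)
  IntervalComplete-· 0≤c complete zero    = IntervalComplete-0
  IntervalComplete-· 0≤c complete (suc n) =
    IntervalComplete-+ 0≤c (0≤x⇒0≤n·x n 0≤c) complete (IntervalComplete-· 0≤c complete n)

  IntervalComplete⇒supremum : (∀ c → IntervalComplete c) →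
    ∀ S → ∃ S → ∃ (IsUpperBound S) → ∃ (IsSup S)
  IntervalComplete⇒supremum complete S (x₀ , Sx₀) (b , b-ub) =
    let t , sup = complete (b - x₀) S₀ (_ , x₀ , Sx₀ , refl) S₀⊆[0,b-x₀]
    in t + x₀ , IsSup-resp-upperBounds (ub-⊞⇒ub , ub⇒ub-⊞) (IsSup-⊞ sup (IsSup-singleton x₀))
    where
    S₀ : Pred Carrier 0ℓ
    S₀ = image _≈_ (λ x → (x - x₀) ∨ 0#) S

    S₀⊆[0,b-x₀] : ∀ {x} → S₀ x → 0# ≤ x × x ≤ b - x₀
    S₀⊆[0,b-x₀] (y , Sy , eq) =
      ≤-respʳ-≈ eq (y≤x∨y _ 0#) ,
      ≤-respˡ-≈ eq (∨-least (+-monoˡ-≤ (- x₀) (b-ub y Sy))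
                            (≤-respˡ-≈ (-‿inverseʳ x₀) (+-monoˡ-≤ (- x₀) (b-ub x₀ Sx₀))))

    [y-x₀]∨0+x₀≈y∨x₀ : ∀ y → ((y - x₀) ∨ 0#) + x₀ ≈ y ∨ x₀
    [y-x₀]∨0+x₀≈y∨x₀ y = trans (+-congʳ ([x-c]∨0≈x∨c-c y x₀)) (//-rightDividesˡ x₀ (y ∨ x₀))

    ub-⊞⇒ub : IsUpperBound (S₀ ⊞ (_≈ x₀)) ⊆ IsUpperBound S
    ub-⊞⇒ub c-ub y Sy = ≤-trans (x≤x∨y y x₀)
      (≤-respˡ-≈ ([y-x₀]∨0+x₀≈y∨x₀ y) (c-ub _ (_ , x₀ , (y , Sy , refl) , refl , refl)))

    ub⇒ub-⊞ : IsUpperBound S ⊆ IsUpperBound (S₀ ⊞ (_≈ x₀))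
    ub⇒ub-⊞ c-ub z (_ , _ , (y , Sy , eq) , x≈x₀ , w+x≈z) =
      ≤-respˡ-≈ (trans (sym ([y-x₀]∨0+x₀≈y∨x₀ y)) (trans (+-cong eq (sym x≈x₀)) w+x≈z))
                (∨-least (c-ub y Sy) (c-ub x₀ Sx₀))

  IntervalComplete⇒infimum : (∀ c → IntervalComplete c) →
    ∀ S → ∃ S → ∃ (IsLowerBound S) → ∃ (IsInf S)
  IntervalComplete⇒infimum complete S (x₀ , Sx₀) (l , l-lb) =
    let s , sup = IntervalComplete⇒supremum complete (image _≈_ -_ S) (- x₀ , x₀ , Sx₀ , refl)
                    (- l , λ z (x , Sx , -x≈z) → ≤-respˡ-≈ -x≈z (neg-antimono-≤ (l-lb x Sx)))
    in - s , IsSup-neg⇒IsInf sup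

module LUGroupProperties (G : LUGroup) where
  open LUGroup G public
  open LGroupProperties lgroup public
  open SupProperties _≈_ _≤_
  private
    module ΓG = MVAlgebra (Γ G)

  u-0≈u : u - 0# ≈ u
  u-0≈u = trans (+-congˡ ε⁻¹≈ε) (+-identityʳ u)

  Γ-≤⇔≤ : ∀ (x y : ΓG.Carrier) → x ΓG.≤ y ⇔ proj₁ x ≤ proj₁ y
  Γ-≤⇔≤ (x , _) (y , _) = mk⇔
    (λ x≤y → to (c≤c-x+y⇔x≤y u) (trans (∧-comm u _) (trans x≤y u-0≈u)))
    (λ x≤y → trans (∧-comm _ u) (trans (from (c≤c-x+y⇔x≤y u) x≤y) (sym u-0≈u)))

  Γ-≤-resp-≈ : ΓG._≤_ Respects₂ ΓG._≈_
  Γ-≤-resp-≈ = (λ {x} {y} {y′} y≈y′ x≤y → from (Γ-≤⇔≤ x y′) (≤-respʳ-≈ y≈y′ (to (Γ-≤⇔≤ x y) x≤y)))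
             , (λ {y} {x} {x′} x≈x′ x≤y → from (Γ-≤⇔≤ x′ y) (≤-respˡ-≈ x≈x′ (to (Γ-≤⇔≤ x y) x≤y)))

  -- 0 is adjoined because the empty join in Γ G is 0, whereas G has no least element
  underlying₀ : Pred ΓG.Carrier 0ℓ → Pred Carrier 0ℓ
  underlying₀ T = image _≈_ proj₁ T ∪ (_≈ 0#)

  Γ-IsUpperBound⇔IsUpperBound : ∀ {T} (b : ΓG.Carrier) →
                                ΓG.IsUpperBound T b ⇔ IsUpperBound (underlying₀ T) (proj₁ b)
  Γ-IsUpperBound⇔IsUpperBound b@(_ , 0≤b , _) = mk⇔
    (λ { b-ub g (inj₁ (x , Tx , x≈g)) → ≤-respˡ-≈ x≈g (to (Γ-≤⇔≤ x b) (b-ub x Tx))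
       ; b-ub g (inj₂ g≈0)            → ≤-respˡ-≈ (sym g≈0) 0≤b })
    (λ b-ub x Tx → from (Γ-≤⇔≤ x b) (b-ub (proj₁ x) (inj₁ (x , Tx , refl))))

  Γ-IsSup⇔IsSup : ∀ {T} (t : ΓG.Carrier) → ΓG.IsSup T t ⇔ IsSup (underlying₀ T) (proj₁ t)
  Γ-IsSup⇔IsSup {T} t = mk⇔
    (λ (t-ub , least) → to (Γ-IsUpperBound⇔IsUpperBound t) t-ub ,
       λ b b-ub → let b∧u = b ∧ u , ∧-greatest (b-ub 0# (inj₂ refl)) 0≤u , x∧y≤y b u in
         ≤-trans (to (Γ-≤⇔≤ t b∧u) (least b∧u λ x Tx → from (Γ-≤⇔≤ x b∧u)
                   (∧-greatest (b-ub (proj₁ x) (inj₁ (x , Tx , refl))) (proj₂ (proj₂ x)))))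
                 (x∧y≤x b u))
    (λ (t-ub , least) → from (Γ-IsUpperBound⇔IsUpperBound t) t-ub ,
       λ b b-ub → from (Γ-≤⇔≤ t b) (least (proj₁ b) (to (Γ-IsUpperBound⇔IsUpperBound b) b-ub)))

  unitIntervalComplete : IsCompleteMV (Γ G) → IntervalComplete u
  unitIntervalComplete complete S (e , Se) S⊆[0,u] =
    let t , t-sup = complete T
    in proj₁ t , IsSup-resp-upperBounds (ub₀⇒ub , ub⇒ub₀) (to (Γ-IsSup⇔IsSup t) t-sup)
    where
    T : Pred ΓG.Carrier 0ℓ
    T x = S (proj₁ x)

    ub₀⇒ub : IsUpperBound (underlying₀ T) ⊆ IsUpperBound S
    ub₀⇒ub b-ub x Sx = b-ub x (inj₁ ((x , S⊆[0,u] Sx) , Sx , refl))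

    ub⇒ub₀ : IsUpperBound S ⊆ IsUpperBound (underlying₀ T)
    ub⇒ub₀ b-ub g (inj₁ (x , Sx , x≈g)) = ≤-respˡ-≈ x≈g (b-ub (proj₁ x) Sx)
    ub⇒ub₀ b-ub g (inj₂ g≈0)            = ≤-respˡ-≈ (sym g≈0) (≤-trans (proj₁ (S⊆[0,u] Se)) (b-ub e Se))

  intervalComplete : IntervalComplete u → ∀ c → IntervalComplete c
  intervalComplete complete c =
    let n , ∣c∣≤[1+n]u = strong c
    in IntervalComplete-≤ (≤-trans (x≤x∨y c (- c)) ∣c∣≤[1+n]u) (IntervalComplete-· 0≤u complete (suc n))

  IsCompleteMV-Γ⇒IsLUFrame : IsCompleteMV (Γ G) → IsLUFrame G
  IsCompleteMV-Γ⇒IsLUFrame complete S nonempty bounded-above bounded-below =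
    IntervalComplete⇒supremum intervals S nonempty bounded-above ,
    IntervalComplete⇒infimum intervals S nonempty bounded-below
    where intervals = intervalComplete (unitIntervalComplete complete)

  -- x + u ≤ x ∨ u lets one peel a copy of u off any bound x ≤ (1 + n) · u
  x+u≤x∨u⇒x≤0 : ∀ {x} → x + u ≤ x ∨ u → x ≤ 0#
  x+u≤x∨u⇒x≤0 {x} x+u≤x∨u =
    let n , ∣x∣≤[1+n]u = strong x in below (suc n) (≤-trans (x≤x∨y x (- x)) ∣x∣≤[1+n]u)
    where
    below : ∀ n → x ≤ n · u → x ≤ 0#
    below zero    x≤0       = x≤0
    below (suc n) x≤u+n·u = below n (+-cancelʳ-≤ u (begin
      x + u          ≤⟨ x+u≤x∨u ⟩
      x ∨ u          ≤⟨ ∨-least x≤u+n·u (≤-respˡ-≈ (+-identityʳ u) (+-monoʳ-≤ u (0≤x⇒0≤n·x n 0≤u))) ⟩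
      u + n · u      ≈⟨ +-comm u (n · u) ⟩
      n · u + u      ∎))
      where open PosetReasoning poset

  u≤[u-x]∨0⇒x≤0 : ∀ {x} → u ≤ (u - x) ∨ 0# → x ≤ 0#
  u≤[u-x]∨0⇒x≤0 {x} u≤[u-x]∨0 = x+u≤x∨u⇒x≤0 (begin
    x + u                     ≈⟨ +-comm x u ⟩
    u + x                     ≤⟨ +-monoˡ-≤ x u≤[u-x]∨0 ⟩
    ((u - x) ∨ 0#) + x        ≈⟨ +-distribʳ-∨ x (u - x) 0# ⟩
    (u - x + x) ∨ (0# + x)    ≈⟨ ∨-cong (//-rightDividesˡ x u) (+-identityˡ x) ⟩
    u ∨ x                     ≈⟨ ∨-comm u x ⟩
    x ∨ u                     ∎)
    where open PosetReasoning poset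

  clip : Carrier → ΓG.Carrier
  clip x = (x ∨ 0#) ∧ u , ∧-greatest (y≤x∨y x 0#) 0≤u , x∧y≤y (x ∨ 0#) u

  clip-cong : ∀ {x y} → x ≈ y → clip x ΓG.≈ clip y
  clip-cong x≈y = ∧-cong (∨-cong x≈y refl) refl

  clip-mono : ∀ {x y} → x ≤ y → proj₁ (clip x) ≤ proj₁ (clip y)
  clip-mono {x} x≤y = ∧-greatest (≤-trans (x∧y≤x (x ∨ 0#) u) (∨-monotonic x≤y ≤-refl)) (x∧y≤y (x ∨ 0#) u)

  ≤u⇒≤clip : ∀ {x} → x ≤ u → x ≤ proj₁ (clip x)
  ≤u⇒≤clip {x} x≤u = ∧-greatest (x≤x∨y x 0#) x≤u

  clipped : Carrier → Pred Carrier 0ℓ → Pred ΓG.Carrier 0ℓ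
  clipped s S = image ΓG._≈_ (λ x → clip (x + (u - s))) S

  IsSup⇒IsSup-clipped : ∀ {S s} → IsSup S s → ΓG.IsSup (clipped s S) ΓG.1#
  IsSup⇒IsSup-clipped {S} {s} (s-ub , least) =
    (λ y _ → from (Γ-≤⇔≤ y ΓG.1#) (≤-respʳ-≈ (sym u-0≈u) (proj₂ (proj₂ y)))) ,
    (λ b b-ub → from (Γ-≤⇔≤ ΓG.1# b) (≤-respˡ-≈ (sym u-0≈u) (u≤b b b-ub)))
    where
    u≤b : ∀ b → ΓG.IsUpperBound (clipped s S) b → u ≤ proj₁ b
    u≤b b b-ub = ≤-respˡ-≈ (x+[y-x]≈y s u) (x≤z-y⇒x+y≤z (least (proj₁ b - (u - s)) λ x Sx →
      x+y≤z⇒x≤z-y (≤-trans (≤u⇒≤clip (≤-respʳ-≈ (x+[y-x]≈y s u) (+-monoˡ-≤ (u - s) (s-ub x Sx))))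
                           (to (Γ-≤⇔≤ (clip (x + (u - s))) b) (b-ub (clip (x + (u - s))) (x , Sx , refl))))))

  IsSup-clipped⇒IsSup : ∀ {S s} → IsUpperBound S s → ΓG.IsSup (clipped s S) ΓG.1# → IsSup S s
  IsSup-clipped⇒IsSup {S} {s} s-ub (_ , least) = s-ub , λ c c-ub →
    let b = clip (c + (u - s))
        b-ub : ΓG.IsUpperBound (clipped s S) b
        b-ub y (x , Sx , clip≈y) =
          from (Γ-≤⇔≤ y b) (≤-respˡ-≈ clip≈y (clip-mono (+-monoˡ-≤ (u - s) (c-ub x Sx))))
    in x-y≤0⇒x≤y (u≤[u-x]∨0⇒x≤0 (begin
      u                         ≈⟨ u-0≈u ⟨
      u - 0#                    ≤⟨ to (Γ-≤⇔≤ ΓG.1# b) (least b b-ub) ⟩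
      proj₁ b                   ≤⟨ x∧y≤x _ u ⟩
      (c + (u - s)) ∨ 0#        ≈⟨ ∨-cong (x+[y-z]≈y-[z-x] c u s) refl ⟩
      (u - (s - c)) ∨ 0#        ∎))
    where open PosetReasoning poset

module MVAlgebraProperties {A : MVAlgebra} (isA : IsMVAlgebra A) where
  open MVAlgebra A
  open IsMVAlgebra isA

  ≤-resp-≈ : _≤_ Respects₂ _≈_
  ≤-resp-≈ = (λ y≈y′ x≤y → ≈-trans (⊕-cong ≈-refl (≈-sym y≈y′)) x≤y)
           , (λ x≈x′ x≤y → ≈-trans (⊕-cong (¬-cong (≈-sym x≈x′)) ≈-refl) x≤y)

module IsMVHomProperties {A B : MVAlgebra} (isB : IsMVAlgebra B)
                         {f : MVAlgebra.Carrier A → MVAlgebra.Carrier B} (hom : IsMVHom A B f) where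
  private
    module A = MVAlgebra A
    module B = MVAlgebra B
  open IsMVAlgebra isB
  open IsMVHom hom

  1-homo : f A.1# B.≈ B.1#
  1-homo = ≈-trans (¬-homo A.0#) (¬-cong 0-homo)

  ¬x⊕y-homo : ∀ x y → f (A.¬ x A.⊕ y) B.≈ B.¬ f x B.⊕ f y
  ¬x⊕y-homo x y = ≈-trans (⊕-homo (A.¬ x) y) (⊕-cong (¬-homo x) ≈-refl)

  mono : ∀ {x y} → x A.≤ y → f x B.≤ f y
  mono {x} {y} x≤y = ≈-trans (≈-sym (¬x⊕y-homo x y)) (≈-trans (cong x≤y) 1-homo)

module IsMVIsoProperties {A B : MVAlgebra} (isB : IsMVAlgebra B)
                         {f : MVAlgebra.Carrier A → MVAlgebra.Carrier B} (iso : IsMVIso A B f) where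
  private
    module A = MVAlgebra A
    module B = MVAlgebra B
  open IsMVAlgebra isB
  open IsMVIso iso
  open IsMVHomProperties isB isMVHom
  open MVAlgebraProperties isB
  open SupProperties B._≈_ B._≤_

  reflects-≤ : ∀ {x y} → f x B.≤ f y → x A.≤ y
  reflects-≤ {x} {y} fx≤fy = injective (≈-trans (¬x⊕y-homo x y) (≈-trans fx≤fy (≈-sym 1-homo)))

  preservesJoins : PreservesJoins A B f
  preservesJoins T t (ub , least) =
    (λ y (x , Tx , fx≈y) → proj₂ ≤-resp-≈ fx≈y (mono (ub x Tx))) ,
    (λ b b-ub → let a , fa≈b = surjective b in
       proj₁ ≤-resp-≈ fa≈b (mono (least a λ x Tx →
         reflects-≤ (proj₁ ≤-resp-≈ (≈-sym fa≈b) (b-ub (f x) (x , Tx , ≈-refl))))))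

  reflectsJoins : ∀ (T : Pred A.Carrier 0ℓ) t → B.IsSup (image B._≈_ f T) (f t) → A.IsSup T t
  reflectsJoins T t (ub , least) =
    (λ x Tx → reflects-≤ (ub (f x) (x , Tx , ≈-refl))) ,
    (λ b b-ub → reflects-≤ (least (f b) λ y (x , Tx , fx≈y) → proj₂ ≤-resp-≈ fx≈y (mono (b-ub x Tx))))

  reflectsCompleteness : IsCompleteMV B → IsCompleteMV A
  reflectsCompleteness complete T =
    let b , b-sup = complete (image B._≈_ f T)
        t , ft≈b  = surjective b
    in t , reflectsJoins T t
             (IsSup-resp ≤-resp-≈ (λ {y} fx → y , fx , ≈-refl) (λ {y} fx → y , fx , ≈-refl) (≈-sym ft≈b) b-sup)

  -- the domain (Γ H below) is not assumed to satisfy IsMVAlgebra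
  domain-≈-refl : ∀ {x} → x A.≈ x
  domain-≈-refl = injective ≈-refl

preservesJoins-transport :
  ∀ {A′ A B′ B : MVAlgebra} → IsMVAlgebra A → IsMVAlgebra B →
  ∀ {α β φ F} → IsMVIso A′ A α → IsMVIso B′ B β → IsMVHom A B φ →
  (∀ x → MVAlgebra._≈_ B (β (F x)) (φ (α x))) →
  PreservesJoins A B φ → PreservesJoins A′ B′ F
preservesJoins-transport {A′} {A} {B′} {B} isA isB {α} {β} {φ} {F}
                         α-iso β-iso φ-hom β∘F≈φ∘α φ-joins T t t-sup =
  reflectsJoins (image B′._≈_ F T) (F t)
    (IsSup-resp ≤-resp-≈ φαT⊆βFT βFT⊆φαT (≈-sym (β∘F≈φ∘α t))
      (φ-joins _ _ (IsMVIsoProperties.preservesJoins isA α-iso T t t-sup)))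
  where
  module A = MVAlgebra A
  module B = MVAlgebra B
  module B′ = MVAlgebra B′
  open IsMVAlgebra isB
  open MVAlgebraProperties isB
  open IsMVIsoProperties isB β-iso
  open SupProperties B._≈_ B._≤_

  φαT⊆βFT : image B._≈_ φ (image A._≈_ α T) ⊆ image B._≈_ id (image B._≈_ β (image B′._≈_ F T))
  φαT⊆βFT (w , (x , Tx , αx≈w) , φw≈y) =
    β (F x) , (F x , (x , Tx , domain-≈-refl) , ≈-refl) ,
    ≈-trans (β∘F≈φ∘α x) (≈-trans (IsMVHom.cong φ-hom αx≈w) φw≈y)

  βFT⊆φαT : image B._≈_ β (image B′._≈_ F T) ⊆ image B._≈_ id (image B._≈_ φ (image A._≈_ α T))
  βFT⊆φαT (w , (x , Tx , Fx≈w) , βw≈y) =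
    φ (α x) , (α x , (x , Tx , IsMVAlgebra.≈-refl isA) , ≈-refl) ,
    ≈-trans (≈-sym (β∘F≈φ∘α x)) (≈-trans (IsMVHom.cong (IsMVIso.isMVHom β-iso) Fx≈w) βw≈y)

module IsLUHomProperties {G H : LUGroup} {f : LUGroup.Carrier G → LUGroup.Carrier H}
                         (hom : IsLUHom G H f) where
  private
    module G = LUGroupProperties G
    module H = LUGroupProperties H
    module ΓG = MVAlgebra (Γ G)
    module ΓH = MVAlgebra (Γ H)
  open IsLUHom hom
  open SupProperties H._≈_ H._≤_
  private
    module ΓH-Sup = SupProperties ΓH._≈_ ΓH._≤_
  open AbelianGroupProperties H.abelianGroup using (inverseʳ-unique)

  F : ΓG.Carrier → ΓH.Carrier
  F = Γmap G H f hom

  mono : ∀ {x y} → x G.≤ y → f x H.≤ f y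
  mono {x} {y} x≤y = H.trans (H.sym (∧-homo x y)) (cong x≤y)

  neg-homo : ∀ x → f (G.- x) H.≈ H.- f x
  neg-homo x = inverseʳ-unique (f x) (f (G.- x))
    (H.trans (H.sym (+-homo x (G.- x))) (H.trans (cong (G.-‿inverseʳ x)) 0-homo))

  sub-homo : ∀ x y → f (x G.- y) H.≈ f x H.- f y
  sub-homo x y = H.trans (+-homo x (G.- y)) (H.+-congˡ (neg-homo y))

  Γmap-isMVHom : IsMVHom (Γ G) (Γ H) F
  Γmap-isMVHom = record
    { cong   = cong
    ; ⊕-homo = λ x y → H.trans (∧-homo _ G.u) (H.∧-cong (+-homo _ _) u-homo)
    ; ¬-homo = λ x → H.trans (sub-homo G.u _) (H.+-congʳ u-homo)
    ; 0-homo = 0-homo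
    }

  Γmap-1 : F ΓG.1# ΓH.≈ ΓH.1#
  Γmap-1 = H.trans (IsMVHom.¬-homo Γmap-isMVHom ΓG.0#) (H.+-congˡ (H.-‿cong 0-homo))

  Γmap-clip-shift : ∀ x s → F (G.clip (x G.+ (G.u G.- s))) ΓH.≈ H.clip (f x H.+ (H.u H.- f s))
  Γmap-clip-shift x s =
    H.trans (∧-homo _ G.u) (H.∧-cong (H.trans (∨-homo _ G.0#) (H.∨-cong shift-homo 0-homo)) u-homo)
    where
    shift-homo : f (x G.+ (G.u G.- s)) H.≈ f x H.+ (H.u H.- f s)
    shift-homo = H.trans (+-homo x _) (H.+-congˡ (H.trans (sub-homo G.u s) (H.+-congʳ u-homo)))

  PreservesSups : Set₁
  PreservesSups = ∀ (S : Pred G.Carrier 0ℓ) s → G.IsSup S s → H.IsSup (image H._≈_ f S) (f s)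

  PreservesSups⇔Γmap-preservesJoins : PreservesSups ⇔ PreservesJoins (Γ G) (Γ H) F
  PreservesSups⇔Γmap-preservesJoins = mk⇔ preservesSups⇒preservesJoins preservesJoins⇒preservesSups
    where
    preservesSups⇒preservesJoins : PreservesSups → PreservesJoins (Γ G) (Γ H) F
    preservesSups⇒preservesJoins sups T t t-sup =
      from (H.Γ-IsSup⇔IsSup (F t))
        (IsSup-resp H.≤-resp-≈ fT₀⊆FT₀ FT₀⊆fT₀ H.refl (sups _ _ (to (G.Γ-IsSup⇔IsSup t) t-sup)))
      where
      fT₀⊆FT₀ : image H._≈_ f (G.underlying₀ T) ⊆ image H._≈_ id (H.underlying₀ (image ΓH._≈_ F T))
      fT₀⊆FT₀ (g , inj₁ (x , Tx , x≈g) , fg≈y) =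
        f (proj₁ x) , inj₁ (F x , (x , Tx , H.refl) , H.refl) , H.trans (cong x≈g) fg≈y
      fT₀⊆FT₀ (g , inj₂ g≈0 , fg≈y) =
        H.0# , inj₂ H.refl , H.trans (H.sym 0-homo) (H.trans (cong (G.sym g≈0)) fg≈y)

      FT₀⊆fT₀ : H.underlying₀ (image ΓH._≈_ F T) ⊆ image H._≈_ id (image H._≈_ f (G.underlying₀ T))
      FT₀⊆fT₀ (inj₁ (y , (x , Tx , Fx≈y) , y≈z)) =
        f (proj₁ x) , (proj₁ x , inj₁ (x , Tx , G.refl) , H.refl) , H.trans Fx≈y y≈z
      FT₀⊆fT₀ (inj₂ z≈0) =
        f G.0# , (G.0# , inj₂ G.refl , H.refl) , H.trans 0-homo (H.sym z≈0)

    preservesJoins⇒preservesSups : PreservesJoins (Γ G) (Γ H) F → PreservesSups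
    preservesJoins⇒preservesSups joins S s (s-ub , s-least) =
      H.IsSup-clipped⇒IsSup {image H._≈_ f S} (λ z (x , Sx , fx≈z) → H.≤-respˡ-≈ fx≈z (mono (s-ub x Sx)))
        clipped-sup
      where
      FC⊆Cf : image ΓH._≈_ F (G.clipped s S) ⊆ image ΓH._≈_ id (H.clipped (f s) (image H._≈_ f S))
      FC⊆Cf (w , (x , Sx , clip≈w) , Fw≈y) =
        H.clip (f x H.+ (H.u H.- f s)) , (f x , (x , Sx , H.refl) , H.refl) ,
        H.trans (H.sym (Γmap-clip-shift x s)) (H.trans (cong clip≈w) Fw≈y)

      Cf⊆FC : H.clipped (f s) (image H._≈_ f S) ⊆ image ΓH._≈_ id (image ΓH._≈_ F (G.clipped s S))
      Cf⊆FC (z , (x , Sx , fx≈z) , clip≈y) =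
        F (G.clip (x G.+ (G.u G.- s))) , (G.clip (x G.+ (G.u G.- s)) , (x , Sx , G.refl) , H.refl) ,
        H.trans (Γmap-clip-shift x s) (H.trans (H.clip-cong (H.+-congʳ fx≈z)) clip≈y)

      clipped-sup : ΓH.IsSup (H.clipped (f s) (image H._≈_ f S)) ΓH.1#
      clipped-sup = ΓH-Sup.IsSup-resp H.Γ-≤-resp-≈
        {image ΓH._≈_ F (G.clipped s S)} {H.clipped (f s) (image H._≈_ f S)} {F ΓG.1#} {ΓH.1#}
        (λ {y} → FC⊆Cf {y}) (λ {y} → Cf⊆FC {y}) Γmap-1
        (joins (G.clipped s S) ΓG.1# (G.IsSup⇒IsSup-clipped (s-ub , s-least)))

proposition4p2 :
    (∀ (G₁ G₂ : LUGroup) → IsLUFrame G₁ → IsLUFrame G₂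
       → (f : LUGroup.Carrier G₁ → LUGroup.Carrier G₂)
       → (hom : IsLUFrameHom G₁ G₂ f)
       → IsMVHom (Γ G₁) (Γ G₂) (Γmap G₁ G₂ f (IsLUFrameHom.isLUHom hom))
         × PreservesJoins (Γ G₁) (Γ G₂) (Γmap G₁ G₂ f (IsLUFrameHom.isLUHom hom)))
    ×
    (∀ (A B : MVAlgebra) → IsMVAlgebra A → IsMVAlgebra B
       → IsCompleteMV A → IsCompleteMV B
       → (φ : MVAlgebra.Carrier A → MVAlgebra.Carrier B)
       → IsMVHom A B φ → PreservesJoins A B φ
       → ∀ (G H : LUGroup)
       → (α : MVAlgebra.Carrier (Γ G) → MVAlgebra.Carrier A) → IsMVIso (Γ G) A α
       → (β : MVAlgebra.Carrier (Γ H) → MVAlgebra.Carrier B) → IsMVIso (Γ H) B β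
       → (h : LUGroup.Carrier G → LUGroup.Carrier H)
       → (hom : IsLUHom G H h)
       → (∀ x → MVAlgebra._≈_ B (β (Γmap G H h hom x)) (φ (α x)))
       → IsLUFrame G × IsLUFrame H × IsLUFrameHom G H h)
proposition4p2 =
  (λ G₁ G₂ _ _ f frameHom →
    let open IsLUHomProperties (IsLUFrameHom.isLUHom frameHom) in
    Γmap-isMVHom , to PreservesSups⇔Γmap-preservesJoins (IsLUFrameHom.sup-homo frameHom)) ,
  (λ A B isA isB A-complete B-complete φ φ-hom φ-joins G H α α-iso β β-iso h hom β∘Γh≈φ∘α →
    let open IsLUHomProperties hom in
    LUGroupProperties.IsCompleteMV-Γ⇒IsLUFrame G (IsMVIsoProperties.reflectsCompleteness isA α-iso A-complete) ,
    LUGroupProperties.IsCompleteMV-Γ⇒IsLUFrame H (IsMVIsoProperties.reflectsCompleteness isB β-iso B-complete) ,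
    record { isLUHom  = hom
           ; sup-homo = from PreservesSups⇔Γmap-preservesJoins
                          (preservesJoins-transport isA isB α-iso β-iso φ-hom β∘Γh≈φ∘α φ-joins) })
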